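{- Let $(G,\chi)$ be a $1$-robust colored graph with $|V(G)|>1$, let $S\subseteq V(G)$ be a vertex cover of $G$, $I:=V(G)\setminus S$, and suppose $\chi(S)\cap\chi(I)=\emptyset$. Then (i) there is a vertex $u\in V(G)$ with $|\chi_{1,u}(S)|\ge|\chi(S)|+2$, or (ii) there are vertices $u_1,u_2\in V(G)$ with $|\chi_{1,\{u_1,u_2\}}(S)|\ge|\chi(S)|+3$.
   Context: $1$-WL (color refinement) iteratively recolors each vertex by (old color, multiset of neighbors' old colors) until stable. For $U\subseteq V(G)$, $\chi[U]$ gives each vertex of $U$ its own new unique color, and $\chi_{1,U}$ is the stable $1$-WL coloring of $(G,\chi[U])$ ($\chi_{1,u}:=\chi_{1,\{u\}}$). For a set $X$, $\chi(X)=\{\chi(x)\mid x\in X\}$. $(G,\chi)$ is flipped if for all colors $c_1,c_2$ the number of edges between $\chi^{ -1}(c_1)$ and $\chi^{ -1}(c_2)$ is at most half the number of unordered pairs $\{v,w\}$ of distinct vertices with $\chi(v)=c_1,\chi(w)=c_2$. $(G,\chi)$ is $1$-robust if $G$ is connected, $(G,\chi)$ is flipped, and $\chi$ is stable with respect to $1$-WL (not refined by it). A vertex cover is a set of vertices meeting every edge. -}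

module Defs where

open import Data.Nat using (ℕ; zero; suc; _+_; _*_; _≤_; _<_; _≡ᵇ_)
open import Data.Bool using (Bool; true; false; _∧_; _∨_; not; if_then_else_; T)
open import Data.Fin using (Fin; toℕ)
open import Data.Fin.Properties using () renaming (_≟_ to _≟ᶠ_)
open import Data.List using (List; map; allFin; foldr)
open import Data.Nat.ListAction using (sum)
open import Relation.Nullary.Decidable using (⌊_⌋)
open import Relation.Binary.PropositionalEquality using (_≡_; _≢_)
open import Relation.Binary.Construct.Closure.ReflexiveTransitive using (Star)
open import Function using (_∘_)

record Graph : Set where
  field
    n     : ℕ
    adj   : Fin n → Fin n → Bool
    sym   : ∀ v w → adj v w ≡ adj w v
    irrefl : ∀ v → adj v v ≡ false
open Graph public

count : ∀ {m} → (Fin m → Bool) → ℕ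
count {m} p = sum (map (λ i → if p i then 1 else 0) (allFin m))

allᶠ : ∀ {m} → (Fin m → Bool) → Bool
allᶠ {m} p = foldr (λ i b → p i ∧ b) true (allFin m)

anyᶠ : ∀ {m} → (Fin m → Bool) → Bool
anyᶠ {m} p = foldr (λ i b → p i ∨ b) false (allFin m)

_==ᶠ_ : ∀ {m} → Fin m → Fin m → Bool
v ==ᶠ w = ⌊ v ≟ᶠ w ⌋

_<ᶠ_ : ∀ {m} → Fin m → Fin m → Bool
v <ᶠ w = ⌊ Data.Nat._<?_ (toℕ v) (toℕ w) ⌋
  where import Data.Nat

-- A coloring up to renaming of colors: the relation "v and w have the same color"
-- (always an equivalence relation in our uses).
SameColor : ℕ → Set
SameColor m = Fin m → Fin m → Bool

sameOf : ∀ {m} → (Fin m → ℕ) → SameColor m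
sameOf χ v w = χ v ≡ᵇ χ w

-- |χ(X)|: number of distinct colors occurring on X, i.e. the number of
-- v ∈ X such that no w ∈ X with smaller index has the same color as v.
numColors : ∀ {m} → SameColor m → (Fin m → Bool) → ℕ
numColors R X = count (λ v → X v ∧ not (anyᶠ (λ w → X w ∧ (w <ᶠ v) ∧ R w v)))

-- One round of 1-WL (color refinement): v, w keep the same color iff they had
-- the same color and, for every old color class (represented by a vertex x),
-- they have the same number of neighbours in that class (= equal multisets of
-- neighbours' colors).
refine : (G : Graph) → SameColor (n G) → SameColor (n G)
refine G R v w = R v w ∧ allᶠ (λ x →
  count (λ y → adj G v y ∧ R y x) ≡ᵇ count (λ y → adj G w y ∧ R y x))

iterate : ∀ {A : Set} → ℕ → (A → A) → A → A
iterate zero    f a = a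
iterate (suc k) f a = f (iterate k f a)

-- Stable 1-WL coloring: the refinement stabilises after at most |V(G)| rounds
-- (each non-final round strictly increases the number of classes, at most |V|),
-- so we iterate |V(G)| = n G times.
wl : (G : Graph) → SameColor (n G) → SameColor (n G)
wl G R = iterate (n G) (refine G) R

-- χ[U]: every vertex of U gets its own new unique color; others keep χ.
individualize : ∀ {m} → (Fin m → ℕ) → (Fin m → Bool) → SameColor m
individualize χ U v w = (v ==ᶠ w) ∨ (not (U v) ∧ not (U w) ∧ (χ v ≡ᵇ χ w))

χ1 : (G : Graph) → (Fin (n G) → ℕ) → (Fin (n G) → Bool) → SameColor (n G)
χ1 G χ U = wl G (individualize χ U)

singleton : ∀ {m} → Fin m → (Fin m → Bool)
singleton u v = u ==ᶠ v

pair : ∀ {m} → Fin m → Fin m → (Fin m → Bool)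
pair u₁ u₂ v = (u₁ ==ᶠ v) ∨ (u₂ ==ᶠ v)

Connected : Graph → Set
Connected G = ∀ v w → Star (λ x y → T (adj G x y)) v w

-- Unordered pairs of distinct vertices are enumerated as (v,w) with v < w.
pairCol : ∀ {m} → (Fin m → ℕ) → ℕ → ℕ → Fin m → Fin m → Bool
pairCol χ c₁ c₂ v w = (v <ᶠ w) ∧ (((χ v ≡ᵇ c₁) ∧ (χ w ≡ᵇ c₂)) ∨ ((χ v ≡ᵇ c₂) ∧ (χ w ≡ᵇ c₁)))

count₂ : ∀ {m} → (Fin m → Fin m → Bool) → ℕ
count₂ p = sum (map (λ v → count (p v)) (allFin _))

Flipped : (G : Graph) → (Fin (n G) → ℕ) → Set
Flipped G χ = ∀ (c₁ c₂ : ℕ) →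
  2 * count₂ (λ v w → pairCol χ c₁ c₂ v w ∧ adj G v w) ≤ count₂ (pairCol χ c₁ c₂)

Stable : (G : Graph) → (Fin (n G) → ℕ) → Set
Stable G χ = ∀ v w → χ v ≡ χ w → ∀ (c : ℕ) →
  count (λ y → adj G v y ∧ (χ y ≡ᵇ c)) ≡ count (λ y → adj G w y ∧ (χ y ≡ᵇ c))

record OneRobust (G : Graph) (χ : Fin (n G) → ℕ) : Set where
  field
    connected : Connected G
    flipped   : Flipped G χ
    stable    : Stable G χ

VertexCover : (G : Graph) → (Fin (n G) → Bool) → Set
VertexCover G S = ∀ v w → T (adj G v w) → T (S v ∨ S w)

module Submission where

-- Write I for the complement of S; as no colour meets both S and I, S is a union of colour
-- classes. Double counting the edges between two colour classes, stability and the flipped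
-- condition show that a vertex is adjacent to at most half of any colour class (not counting
-- itself). Hence for every neighbour y of u some vertex other than u of colour χ(y) is not
-- adjacent to u, and two vertices with a common neighbour v have a common non-neighbour of
-- colour χ(v). Individualising U makes χ_{1,U} separate neighbours from non-neighbours of each
-- vertex of U, so a class of S containing k such pairwise separated vertices gains k - 1
-- colours. This settles three configurations: an edge inside S (individualise an endpoint), a
-- vertex of I whose neighbours have two colours (individualise it), and a vertex v of S with
-- neighbours x₁, x₂ whose neighbourhoods are incomparable (individualise x₁ and x₂; four
-- vertices of the class of v are separated). If none occurs, let x₀ be a vertex of I of maximum
-- degree. Along every walk from x₀, vertices of S stay adjacent to x₀ and vertices of I have
-- their neighbourhood inside that of x₀; by connectivity this reaches a vertex of S of the
-- colour of a neighbour of x₀ that is not adjacent to x₀, a contradiction.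

open import Defs renaming (sym to adj-sym)

open import Data.Nat using (ℕ; zero; suc; _+_; _*_; _≤_; _<_; _<?_; _≡ᵇ_; _≟_; z≤n; s≤s; >-nonZero)
open import Data.Nat.Properties
open import Data.Nat.ListAction using () renaming (sum to listSum)
open import Algebra.Properties.CommutativeSemigroup *-commutativeSemigroup using (x∙yz≈y∙xz)
open import Algebra.Properties.Semiring.Sum +-*-semiring
  using (sum-syntax; sum-cong-≗; ∑-distrib-+; ∑-comm; sum-replicate-zero; *-distribʳ-sum)
open import Data.Bool using (Bool; true; false; _∧_; _∨_; not; if_then_else_; T)
import Data.Bool as Bool
open import Data.Bool.Properties
  using (T-≡; not-¬; ¬-not; not-injective; ∧-comm; ∧-assoc; ∧-zeroʳ; ∧-identityʳ;
         ∨-identityʳ; ∨-zeroʳ; ∨-idem; ∨-comm; ∧-distribʳ-∨)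
open import Data.Empty using (⊥; ⊥-elim)
open import Data.Fin using (Fin; zero; suc; toℕ; fromℕ<)
import Data.Fin as Fin
open import Data.Fin.Induction using (<-wellFounded)
open import Data.Fin.Properties using (toℕ-injective; toℕ<n; toℕ-fromℕ<; any?) renaming (_≟_ to _≟ᶠ_)
open import Data.List using (List; []; _∷_; map; tabulate; allFin; length; foldr; filter)
open import Data.List.Extrema.Nat using (argmax; argmax-all; f[xs]≤f[argmax])
open import Data.List.Membership.Propositional using (_∈_)
open import Data.List.Membership.Propositional.Properties using (∈-allFin; ∈-filter⁺)
open import Data.List.Properties using (map-tabulate; map-cong)
open import Data.List.Relation.Binary.Pointwise using (Pointwise; []; _∷_; Pointwise-length)
open import Data.List.Relation.Unary.All as All using (All; []; _∷_)
open import Data.List.Relation.Unary.All.Properties using (all-filter)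
open import Data.List.Relation.Unary.AllPairs using (AllPairs; []; _∷_)
open import Data.List.Relation.Unary.Any using (here; there)
open import Data.List.Relation.Unary.Unique.Propositional using (Unique)
open import Data.Product using (∃; ∃₂; _×_; _,_; proj₁; proj₂)
open import Data.Sum using (_⊎_; inj₁; inj₂)
open import Function using (id; _∘_)
open import Function.Bundles using (mk⇔; Equivalence)
open import Induction.WellFounded using (Acc; acc)
open import Relation.Binary.Construct.Closure.ReflexiveTransitive using (Star; ε; _◅_)
open import Relation.Binary.Definitions using (tri<; tri≈; tri>)
open import Relation.Binary.PropositionalEquality
open import Relation.Binary.Structures using (IsEquivalence)
open import Relation.Nullary using (Dec; does; yes; no; ¬_; _×-dec_; ¬?)
open import Relation.Nullary.Decidable using (dec-true; dec-false; isYes; isYes≗does; does-⇔)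
open import Relation.Unary using (Decidable)

-- `_==ᶠ_` and `_<ᶠ_` are `isYes` of a decision, whereas `m ≡ᵇ n` is definitionally
-- `does (m ≟ n)`; hence the two families of lemmas.
does⇒ : ∀ {A : Set} (a? : Dec A) → does a? ≡ true → A
does⇒ (yes a) _ = a

isYes⇒ : ∀ {A : Set} (a? : Dec A) → isYes a? ≡ true → A
isYes⇒ (yes a) _ = a

isYes-true : ∀ {A : Set} (a? : Dec A) → A → isYes a? ≡ true
isYes-true a? a = trans (isYes≗does a?) (dec-true a? a)

isYes-false : ∀ {A : Set} (a? : Dec A) → ¬ A → isYes a? ≡ false
isYes-false a? ¬a = trans (isYes≗does a?) (dec-false a? ¬a)

==ᶠ-false⇒≢ : ∀ {m} {v w : Fin m} → (v ==ᶠ w) ≡ false → v ≢ w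
==ᶠ-false⇒≢ {v = v} {w} v≠w v≡w = not-¬ (isYes-true (v ≟ᶠ w) v≡w) v≠w

==ᶠ-sym : ∀ {m} (v w : Fin m) → (v ==ᶠ w) ≡ (w ==ᶠ v)
==ᶠ-sym v w =
  trans (isYes≗does (v ≟ᶠ w)) (trans (does-⇔ (mk⇔ sym sym) (v ≟ᶠ w) (w ≟ᶠ v)) (sym (isYes≗does (w ≟ᶠ v))))

suc-==ᶠ : ∀ {m} (v w : Fin m) → (suc v ==ᶠ suc w) ≡ (v ==ᶠ w)
suc-==ᶠ v w with v ≟ᶠ w
... | yes _ = refl
... | no _ = refl

∧-true⇒ : ∀ {a b} → (a ∧ b) ≡ true → a ≡ true × b ≡ true
∧-true⇒ {true} {true} _ = refl , refl

∨-true⇒ : ∀ {a b} → (a ∨ b) ≡ true → a ≡ true ⊎ b ≡ true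
∨-true⇒ {true} _ = inj₁ refl
∨-true⇒ {false} b = inj₂ b

∨-false⇒ : ∀ {a b} → (a ∨ b) ≡ false → a ≡ false × b ≡ false
∨-false⇒ {false} {false} _ = refl , refl

allᶠ-true⇒ : ∀ {m} {p : Fin m → Bool} → allᶠ p ≡ true → ∀ i → p i ≡ true
allᶠ-true⇒ {m} {p} all i = go (allFin m) all (∈-allFin i)
  where
  go : ∀ xs → foldr (λ j b → p j ∧ b) true xs ≡ true → i ∈ xs → p i ≡ true
  go (x ∷ xs) all (here refl) = proj₁ (∧-true⇒ all)
  go (x ∷ xs) all (there i∈xs) = go xs (proj₂ (∧-true⇒ {p x} all)) i∈xs

allᶠ-true : ∀ {m} {p : Fin m → Bool} → (∀ i → p i ≡ true) → allᶠ p ≡ true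
allᶠ-true {m} {p} every = go (allFin m)
  where
  go : ∀ xs → foldr (λ j b → p j ∧ b) true xs ≡ true
  go [] = refl
  go (x ∷ xs) = cong₂ _∧_ (every x) (go xs)

anyᶠ-true⇒ : ∀ {m} {p : Fin m → Bool} → anyᶠ p ≡ true → ∃ λ i → p i ≡ true
anyᶠ-true⇒ {m} {p} = go (allFin m)
  where
  go : ∀ xs → foldr (λ j b → p j ∨ b) false xs ≡ true → ∃ λ i → p i ≡ true
  go (x ∷ xs) some with p x in px
  ... | true = x , px
  ... | false = go xs some

anyᶠ-true : ∀ {m} {p : Fin m → Bool} {i : Fin m} → p i ≡ true → anyᶠ p ≡ true
anyᶠ-true {m} {p} {i} pi = go (allFin m) (∈-allFin i)
  where
  go : ∀ xs → i ∈ xs → foldr (λ j b → p j ∨ b) false xs ≡ true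
  go (x ∷ xs) (here refl) = cong (_∨ foldr (λ j b → p j ∨ b) false xs) pi
  go (x ∷ xs) (there i∈xs) = trans (cong (p x ∨_) (go xs i∈xs)) (∨-zeroʳ (p x))

indicator : Bool → ℕ
indicator b = if b then 1 else 0

listSum-allFin : ∀ {m} (f : Fin m → ℕ) → listSum (map f (allFin m)) ≡ ∑[ i < m ] f i
listSum-allFin {m} f = trans (cong listSum (map-tabulate id f)) (listSum-tabulate f)
  where
  listSum-tabulate : ∀ {k} (g : Fin k → ℕ) → listSum (tabulate g) ≡ ∑[ i < k ] g i
  listSum-tabulate {zero} g = refl
  listSum-tabulate {suc k} g = cong (g zero +_) (listSum-tabulate (g ∘ suc))

∑-mono-≤ : ∀ {m} {f g : Fin m → ℕ} → (∀ i → f i ≤ g i) → ∑[ i < m ] f i ≤ ∑[ i < m ] g i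
∑-mono-≤ {zero} _ = z≤n
∑-mono-≤ {suc m} f≤g = +-mono-≤ (f≤g zero) (∑-mono-≤ (f≤g ∘ suc))

∑-positive : ∀ {m} (f : Fin m → ℕ) → 0 < ∑[ i < m ] f i → ∃ λ i → 0 < f i
∑-positive {suc m} f pos with f zero in eq
... | suc _ = zero , subst (0 <_) (sym eq) (s≤s z≤n)
... | zero with ∑-positive (f ∘ suc) pos
...   | i , fi>0 = suc i , fi>0

∑-indicator-==ᶠ : ∀ {m} (x : Fin m) → ∑[ y < m ] indicator (y ==ᶠ x) ≡ 1
∑-indicator-==ᶠ {suc m} zero = cong suc (sum-replicate-zero m)
∑-indicator-==ᶠ {suc m} (suc x) =
  trans (sum-cong-≗ (λ y → cong indicator (suc-==ᶠ y x))) (∑-indicator-==ᶠ x)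

_⊆ᵇ_ : ∀ {m} → (Fin m → Bool) → (Fin m → Bool) → Set
p ⊆ᵇ q = ∀ i → p i ≡ true → q i ≡ true

_∖_ : ∀ {m} → (Fin m → Bool) → Fin m → Fin m → Bool
(p ∖ v) w = p w ∧ not (w ==ᶠ v)

module _ {m : ℕ} where

  count-∑ : (p : Fin m → Bool) → count p ≡ ∑[ i < m ] indicator (p i)
  count-∑ p = listSum-allFin (indicator ∘ p)

  count₂-∑ : (p : Fin m → Fin m → Bool) → count₂ p ≡ ∑[ v < m ] count (p v)
  count₂-∑ p = listSum-allFin (λ v → count (p v))

  count-cong : {p q : Fin m → Bool} → (∀ i → p i ≡ q i) → count p ≡ count q
  count-cong p≗q = cong listSum (map-cong (cong indicator ∘ p≗q) (allFin m))

  count₂-cong : {p q : Fin m → Fin m → Bool} → (∀ v w → p v w ≡ q v w) → count₂ p ≡ count₂ q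
  count₂-cong p≗q = cong listSum (map-cong (count-cong ∘ p≗q) (allFin m))

  count-+ : (p q : Fin m → Bool) → count p + count q ≡ ∑[ i < m ] (indicator (p i) + indicator (q i))
  count-+ p q =
    trans (cong₂ _+_ (count-∑ p) (count-∑ q)) (sym (∑-distrib-+ (indicator ∘ p) (indicator ∘ q)))

  count-additive : (r p q : Fin m → Bool) → (∀ i → indicator (r i) ≡ indicator (p i) + indicator (q i)) →
    count r ≡ count p + count q
  count-additive r p q r≡p+q = trans (count-∑ r) (trans (sum-cong-≗ r≡p+q) (sym (count-+ p q)))

  count₂-additive : (r p q : Fin m → Fin m → Bool) →
    (∀ v w → indicator (r v w) ≡ indicator (p v w) + indicator (q v w)) → count₂ r ≡ count₂ p + count₂ q
  count₂-additive r p q r≡p+q = begin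
    count₂ r                                        ≡⟨ count₂-∑ r ⟩
    ∑[ v < m ] count (r v)                          ≡⟨ sum-cong-≗ (λ v → count-additive _ _ _ (r≡p+q v)) ⟩
    ∑[ v < m ] (count (p v) + count (q v))          ≡⟨ ∑-distrib-+ (count ∘ p) (count ∘ q) ⟩
    ∑[ v < m ] count (p v) + ∑[ v < m ] count (q v) ≡⟨ sym (cong₂ _+_ (count₂-∑ p) (count₂-∑ q)) ⟩
    count₂ p + count₂ q                             ∎
    where open ≡-Reasoning

  count-split : (p q : Fin m → Bool) → count p ≡ count (λ i → p i ∧ q i) + count (λ i → p i ∧ not (q i))
  count-split p q = count-additive p _ _ (λ i → split (p i) (q i))
    where
    split : ∀ a b → indicator a ≡ indicator (a ∧ b) + indicator (a ∧ not b)
    split false _ = refl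
    split true false = refl
    split true true = refl

  count-∨ : (p q : Fin m → Bool) → count (λ i → p i ∨ q i) + count (λ i → p i ∧ q i) ≡ count p + count q
  count-∨ p q =
    trans (count-+ _ _) (trans (sum-cong-≗ (λ i → inclusion-exclusion (p i) (q i))) (sym (count-+ p q)))
    where
    inclusion-exclusion : ∀ a b → indicator (a ∨ b) + indicator (a ∧ b) ≡ indicator a + indicator b
    inclusion-exclusion false b = +-identityʳ (indicator b)
    inclusion-exclusion true false = refl
    inclusion-exclusion true true = refl

  count-mono : {p q : Fin m → Bool} → p ⊆ᵇ q → count p ≤ count q
  count-mono {p} {q} p⊆q =
    subst₂ _≤_ (sym (count-∑ p)) (sym (count-∑ q)) (∑-mono-≤ (λ i → mono (p⊆q i)))
    where
    mono : ∀ {a b} → (a ≡ true → b ≡ true) → indicator a ≤ indicator b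
    mono {false} _ = z≤n
    mono {true} a⇒b rewrite a⇒b refl = ≤-refl

  count-false : (p : Fin m → Bool) → (∀ i → p i ≡ false) → count p ≡ 0
  count-false p p≡false = trans (count-cong p≡false) (trans (count-∑ _) (sum-replicate-zero m))

  count-witness : (p : Fin m → Bool) → 0 < count p → ∃ λ i → p i ≡ true
  count-witness p pos with ∑-positive (indicator ∘ p) (subst (0 <_) (count-∑ p) pos)
  ... | i , _ with p i in pi
  ...   | true = i , pi
  count-witness p pos | i , () | false

  count-const∧ : (c : Bool) (q : Fin m → Bool) → count (λ i → c ∧ q i) ≡ indicator c * count q
  count-const∧ false q = count-false _ (λ _ → refl)
  count-const∧ true q = sym (+-identityʳ (count q))

  count-at : (p : Fin m → Bool) (v : Fin m) → count (λ w → p w ∧ (w ==ᶠ v)) ≡ indicator (p v)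
  count-at p v = begin
    count (λ w → p w ∧ (w ==ᶠ v))     ≡⟨ count-cong at-v ⟩
    count (λ w → p v ∧ (w ==ᶠ v))     ≡⟨ count-const∧ (p v) (_==ᶠ v) ⟩
    indicator (p v) * count (_==ᶠ v)  ≡⟨ cong (indicator (p v) *_) (trans (count-∑ _) (∑-indicator-==ᶠ v)) ⟩
    indicator (p v) * 1               ≡⟨ *-identityʳ _ ⟩
    indicator (p v)                   ∎
    where
    open ≡-Reasoning
    at-v : ∀ w → (p w ∧ (w ==ᶠ v)) ≡ (p v ∧ (w ==ᶠ v))
    at-v w with w ==ᶠ v in w≡v
    ... | true = cong (λ x → p x ∧ true) (isYes⇒ (w ≟ᶠ v) w≡v)
    ... | false = trans (∧-zeroʳ (p w)) (sym (∧-zeroʳ (p v)))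

  count-split-at : (p : Fin m → Bool) (v : Fin m) → count p ≡ indicator (p v) + count (p ∖ v)
  count-split-at p v = trans (count-split p (_==ᶠ v)) (cong (_+ count (p ∖ v)) (count-at p v))

  count-remove : (p : Fin m → Bool) {v : Fin m} → p v ≡ true → count p ≡ suc (count (p ∖ v))
  count-remove p {v} pv = trans (count-split-at p v) (cong (λ b → indicator b + count (p ∖ v)) pv)

  count-∖-cong : (p : Fin m → Bool) {u v : Fin m} → p v ≡ p u → count (p ∖ v) ≡ count (p ∖ u)
  count-∖-cong p {u} {v} pv≡pu = +-cancelˡ-≡ (indicator (p v)) _ _ (begin
    indicator (p v) + count (p ∖ v) ≡⟨ sym (count-split-at p v) ⟩
    count p                         ≡⟨ count-split-at p u ⟩
    indicator (p u) + count (p ∖ u) ≡⟨ cong (λ b → indicator b + count (p ∖ u)) (sym pv≡pu) ⟩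
    indicator (p v) + count (p ∖ u) ∎)
    where open ≡-Reasoning

  count-positive : (p : Fin m → Bool) {i : Fin m} → p i ≡ true → 0 < count p
  count-positive p pi = subst (0 <_) (sym (count-remove p pi)) (s≤s z≤n)

  length≤count : (p : Fin m → Bool) {xs : List (Fin m)} → Unique xs → All (λ x → p x ≡ true) xs →
    length xs ≤ count p
  length≤count p [] [] = z≤n
  length≤count p {x ∷ _} (x∉xs ∷ unique) (px ∷ pxs) =
    subst (suc _ ≤_) (sym (count-remove p px)) (s≤s (length≤count _ unique (All.zipWith removed (pxs , x∉xs))))
    where
    removed : ∀ {y} → p y ≡ true × x ≢ y → (p ∖ x) y ≡ true
    removed {y} (py , x≢y) = cong₂ (λ a b → a ∧ not b) py (isYes-false (y ≟ᶠ x) (x≢y ∘ sym))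

  count-subsingleton : (p : Fin m → Bool) → (∀ {i j} → p i ≡ true → p j ≡ true → i ≡ j) → count p ≤ 1
  count-subsingleton p unique with count p in c
  ... | zero = z≤n
  ... | suc k with count-witness p (subst (0 <_) (sym c) (s≤s z≤n))
  ...   | i , pi = ≤-reflexive (trans (sym c) (trans (count-remove p pi) (cong suc (count-false _ others))))
    where
    others : ∀ j → (p ∖ i) j ≡ false
    others j with p j in pj
    ... | false = refl
    ... | true = cong not (isYes-true (j ≟ᶠ i) (unique pj pi))

  count-≤⇒⊇ : {p q : Fin m → Bool} → p ⊆ᵇ q → count q ≤ count p → q ⊆ᵇ p
  count-≤⇒⊇ {p} {q} p⊆q q≤p i qi with p i in pi
  ... | true = refl
  ... | false = ⊥-elim (<⇒≱ p<q q≤p)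
    where
    q∧p≡p : ∀ j → (q j ∧ p j) ≡ p j
    q∧p≡p j with p j in pj
    ... | true = trans (∧-identityʳ (q j)) (p⊆q j pj)
    ... | false = ∧-zeroʳ (q j)
    p<q : count p < count q
    p<q = subst₂ _<_ (count-cong q∧p≡p) (sym (count-split q p))
      (m<m+n _ (count-positive (λ j → q j ∧ not (p j)) (cong₂ (λ a b → a ∧ not b) qi pi)))

  count-disjoint-≤ : {p q r : Fin m → Bool} → (∀ i → (p i ∧ q i) ≡ false) → p ⊆ᵇ r → q ⊆ᵇ r →
    count p + count q ≤ count r
  count-disjoint-≤ {p} {q} {r} disjoint p⊆r q⊆r = begin
    count p + count q           ≡⟨ sym (count-∨ p q) ⟩
    U + count (λ i → p i ∧ q i) ≡⟨ cong (U +_) (count-false _ disjoint) ⟩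
    U + 0                       ≡⟨ +-identityʳ U ⟩
    U                           ≤⟨ count-mono {p = λ i → p i ∨ q i} union⊆r ⟩
    count r                     ∎
    where
    open ≤-Reasoning
    U : ℕ
    U = count (λ i → p i ∨ q i)
    union⊆r : ∀ i → (p i ∨ q i) ≡ true → r i ≡ true
    union⊆r i e with ∨-true⇒ {p i} e
    ... | inj₁ pi = p⊆r i pi
    ... | inj₂ qi = q⊆r i qi

  count₂-transpose : (p : Fin m → Fin m → Bool) → count₂ p ≡ count₂ (λ v w → p w v)
  count₂-transpose p = begin
    count₂ p                                ≡⟨ count₂-∑ p ⟩
    ∑[ v < m ] count (p v)                  ≡⟨ sum-cong-≗ (λ v → count-∑ (p v)) ⟩
    ∑[ v < m ] ∑[ w < m ] indicator (p v w) ≡⟨ ∑-comm (λ v w → indicator (p v w)) ⟩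
    ∑[ w < m ] ∑[ v < m ] indicator (p v w) ≡⟨ sym (sum-cong-≗ (λ w → count-∑ (λ v → p v w))) ⟩
    ∑[ w < m ] count (λ v → p v w)          ≡⟨ sym (count₂-∑ _) ⟩
    count₂ (λ v w → p w v)                  ∎
    where open ≡-Reasoning

  count₂-constant-fibres : (A : Fin m → Bool) (q : Fin m → Fin m → Bool) (c : ℕ) →
    (∀ v → A v ≡ true → count (q v) ≡ c) → count₂ (λ v w → A v ∧ q v w) ≡ count A * c
  count₂-constant-fibres A q c fibre = begin
    count₂ (λ v w → A v ∧ q v w)         ≡⟨ count₂-∑ _ ⟩
    ∑[ v < m ] count (λ w → A v ∧ q v w) ≡⟨ sum-cong-≗ (λ v → trans (count-const∧ (A v) (q v)) (constant v)) ⟩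
    ∑[ v < m ] (indicator (A v) * c)     ≡⟨ sym (*-distribʳ-sum c (indicator ∘ A)) ⟩
    (∑[ v < m ] indicator (A v)) * c     ≡⟨ cong (_* c) (sym (count-∑ A)) ⟩
    count A * c                          ∎
    where
    open ≡-Reasoning
    constant : ∀ v → indicator (A v) * count (q v) ≡ indicator (A v) * c
    constant v with A v in Av
    ... | true = cong (_+ 0) (fibre v Av)
    ... | false = refl

  count₂-symmetric : (h : Fin m → Fin m → Bool) → (∀ v w → h v w ≡ h w v) → (∀ v → h v v ≡ false) →
    count₂ h ≡ 2 * count₂ (λ v w → (v <ᶠ w) ∧ h v w)
  count₂-symmetric h h-sym h-irrefl = begin
    count₂ h                              ≡⟨ count₂-additive h _ _ by-order ⟩
    L + count₂ (λ v w → (w <ᶠ v) ∧ h v w) ≡⟨ cong (L +_) (count₂-transpose _) ⟩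
    L + count₂ (λ v w → (v <ᶠ w) ∧ h w v) ≡⟨ cong (L +_) (count₂-cong (λ v w → cong ((v <ᶠ w) ∧_) (h-sym w v))) ⟩
    L + L                                 ≡⟨ cong (L +_) (sym (+-identityʳ L)) ⟩
    2 * L                                 ∎
    where
    open ≡-Reasoning
    L : ℕ
    L = count₂ (λ v w → (v <ᶠ w) ∧ h v w)
    by-order : ∀ v w → indicator (h v w) ≡ indicator ((v <ᶠ w) ∧ h v w) + indicator ((w <ᶠ v) ∧ h v w)
    by-order v w with <-cmp (toℕ v) (toℕ w)
    ... | tri< v<w _ w≮v rewrite isYes-true (toℕ v <? toℕ w) v<w | isYes-false (toℕ w <? toℕ v) w≮v =
      sym (+-identityʳ _)
    ... | tri> v≮w _ w<v rewrite isYes-false (toℕ v <? toℕ w) v≮w | isYes-true (toℕ w <? toℕ v) w<v = refl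
    ... | tri≈ v≮w v≡w w≮v rewrite isYes-false (toℕ v <? toℕ w) v≮w | isYes-false (toℕ w <? toℕ v) w≮v
                               | toℕ-injective v≡w | h-irrefl w = refl

  count₂-swap : (A B : Fin m → Bool) (r : Fin m → Fin m → Bool) → (∀ v w → r v w ≡ r w v) →
    count₂ (λ v w → B v ∧ (A w ∧ r v w)) ≡ count₂ (λ v w → A v ∧ (B w ∧ r v w))
  count₂-swap A B r r-sym = trans (count₂-transpose _) (count₂-cong rearrange)
    where
    rearrange : ∀ v w → (B w ∧ (A v ∧ r w v)) ≡ (A v ∧ (B w ∧ r v w))
    rearrange v w rewrite r-sym w v with A v | B w
    ... | true | true = refl
    ... | true | false = refl
    ... | false | true = refl
    ... | false | false = refl

  count₂-disjoint-pair : (A B : Fin m → Bool) (r : Fin m → Fin m → Bool) → (∀ v w → r v w ≡ r w v) →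
    (∀ v → (A v ∧ B v) ≡ false) →
    count₂ (λ v w → ((A v ∧ B w) ∨ (B v ∧ A w)) ∧ r v w) ≡ 2 * count₂ (λ v w → A v ∧ (B w ∧ r v w))
  count₂-disjoint-pair A B r r-sym disjoint = begin
    count₂ (λ v w → ((A v ∧ B w) ∨ (B v ∧ A w)) ∧ r v w) ≡⟨ count₂-additive _ _ _ split ⟩
    X + count₂ (λ v w → B v ∧ (A w ∧ r v w))             ≡⟨ cong (X +_) (count₂-swap A B r r-sym) ⟩
    X + X                                                ≡⟨ cong (X +_) (sym (+-identityʳ X)) ⟩
    2 * X                                                ∎
    where
    open ≡-Reasoning
    X : ℕ
    X = count₂ (λ v w → A v ∧ (B w ∧ r v w))
    split : ∀ v w → indicator (((A v ∧ B w) ∨ (B v ∧ A w)) ∧ r v w) ≡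
                    indicator (A v ∧ (B w ∧ r v w)) + indicator (B v ∧ (A w ∧ r v w))
    split v w with A v in Av | B v in Bv
    ... | true | true with () ← trans (sym (cong₂ _∧_ Av Bv)) (disjoint v)
    ... | true | false rewrite ∨-identityʳ (B w) = sym (+-identityʳ _)
    ... | false | true = refl
    ... | false | false = refl

maximum-on : ∀ {m} (f : Fin m → ℕ) (p : Fin m → Bool) {i} → p i ≡ true →
  ∃ λ j → p j ≡ true × (∀ k → p k ≡ true → f k ≤ f j)
maximum-on {m} f p {i} pi = argmax f i candidates , argmax-all f pi (all-filter p? (allFin m)) , bound
  where
  p? : Decidable (λ k → p k ≡ true)
  p? k = p k Bool.≟ true
  candidates : List (Fin m)
  candidates = filter p? (allFin m)
  bound : ∀ k → p k ≡ true → f k ≤ f (argmax f i candidates)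
  bound k pk = All.lookup (f[xs]≤f[argmax] i candidates) (∈-filter⁺ p? (∈-allFin k) pk)

-- Flipped stable colourings

module _ (G : Graph) (χ : Fin (n G) → ℕ) where

  private
    V : Set
    V = Fin (n G)

  colourDegree : ℕ → V → ℕ
  colourDegree b u = count (λ y → adj G u y ∧ (χ y ≡ᵇ b))

  colourPair : ℕ → ℕ → V → V → Bool
  colourPair a b v w = ((χ v ≡ᵇ a) ∧ (χ w ≡ᵇ b)) ∨ ((χ v ≡ᵇ b) ∧ (χ w ≡ᵇ a))

  colourPair-sym : ∀ a b v w → colourPair a b v w ≡ colourPair a b w v
  colourPair-sym a b v w =
    trans (∨-comm (A v ∧ B w) (B v ∧ A w)) (cong₂ _∨_ (∧-comm (B v) (A w)) (∧-comm (A v) (B w)))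
    where
    A B : V → Bool
    A x = χ x ≡ᵇ a
    B x = χ x ≡ᵇ b

  flipped-on-ordered-pairs : Flipped G χ → ∀ a b →
    2 * count₂ (λ v w → colourPair a b v w ∧ adj G v w) ≤ count₂ (λ v w → colourPair a b v w ∧ not (v ==ᶠ w))
  flipped-on-ordered-pairs flipped a b = subst₂ _≤_ (sym edges) (sym pairs) (*-monoʳ-≤ 2 (flipped a b))
    where
    edges : 2 * count₂ (λ v w → colourPair a b v w ∧ adj G v w) ≡
            2 * (2 * count₂ (λ v w → pairCol χ a b v w ∧ adj G v w))
    edges = cong (2 *_) (trans
      (count₂-symmetric _ (λ v w → cong₂ _∧_ (colourPair-sym a b v w) (adj-sym G v w))
        (λ v → trans (cong (colourPair a b v v ∧_) (irrefl G v)) (∧-zeroʳ _)))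
      (cong (2 *_) (count₂-cong (λ v w → sym (∧-assoc (v <ᶠ w) (colourPair a b v w) (adj G v w))))))
    pairs : count₂ (λ v w → colourPair a b v w ∧ not (v ==ᶠ w)) ≡ 2 * count₂ (pairCol χ a b)
    pairs = trans
      (count₂-symmetric _ (λ v w → cong₂ (λ x y → x ∧ not y) (colourPair-sym a b v w) (==ᶠ-sym v w))
        (λ v → trans (cong (λ x → colourPair a b v v ∧ not x) (isYes-true (v ≟ᶠ v) refl)) (∧-zeroʳ _)))
      (cong (2 *_) (count₂-cong ordered))
      where
      ordered : ∀ v w → ((v <ᶠ w) ∧ (colourPair a b v w ∧ not (v ==ᶠ w))) ≡ pairCol χ a b v w
      ordered v w with v <ᶠ w in v<w
      ... | false = refl
      ... | true = trans (cong (λ x → colourPair a b v w ∧ not x) (isYes-false (v ≟ᶠ w) v≢w)) (∧-identityʳ _)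
        where
        v≢w : v ≢ w
        v≢w refl = <-irrefl refl (isYes⇒ (toℕ v <? toℕ v) v<w)

  -- Double counting: by stability, each of the C vertices of colour a = χ u has D neighbours of
  -- colour b, so the flipped condition for (a, b) reads k·C·2D ≤ k·C·K, with k = 1 if a = b and
  -- k = 2 otherwise.
  colourDegree-bound : Stable G χ → Flipped G χ → ∀ u b → 2 * colourDegree b u ≤ count ((λ y → χ y ≡ᵇ b) ∖ u)
  colourDegree-bound stable flipped u b =
    *-cancelˡ-≤ C {{>-nonZero (count-positive A (dec-true (a ≟ a) refl))}} (scaled (a ≟ b))
    where
    a C D K : ℕ
    a = χ u
    A B : V → Bool
    A x = χ x ≡ᵇ a
    B x = χ x ≡ᵇ b
    C = count A
    D = colourDegree b u
    K = count (B ∖ u)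
    distinct : V → V → Bool
    distinct v w = not (v ==ᶠ w)
    distinct-sym : ∀ v w → distinct v w ≡ distinct w v
    distinct-sym v w = cong not (==ᶠ-sym v w)
    edges : count₂ (λ v w → A v ∧ (B w ∧ adj G v w)) ≡ C * D
    edges = count₂-constant-fibres A _ D λ v Av →
      trans (count-cong (λ w → ∧-comm (B w) (adj G v w))) (stable v u (does⇒ (χ v ≟ a) Av) b)
    pairs : count₂ (λ v w → A v ∧ (B w ∧ distinct v w)) ≡ C * K
    pairs = count₂-constant-fibres A _ K λ v Av →
      trans (count-cong (λ w → cong (λ x → B w ∧ not x) (==ᶠ-sym v w)))
            (count-∖-cong B (cong (_≡ᵇ b) (does⇒ (χ v ≟ a) Av)))
    same-colour : ∀ r v w → (colourPair a a v w ∧ r) ≡ (A v ∧ (A w ∧ r))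
    same-colour r v w = trans (cong (_∧ r) (∨-idem (A v ∧ A w))) (∧-assoc (A v) (A w) r)
    scaled : Dec (a ≡ b) → C * (2 * D) ≤ C * K
    scaled (yes refl) = subst₂ _≤_
      (trans (cong (2 *_) (trans (count₂-cong (λ v w → same-colour (adj G v w) v w)) edges)) (x∙yz≈y∙xz 2 C D))
      (trans (count₂-cong (λ v w → same-colour (distinct v w) v w)) pairs)
      (flipped-on-ordered-pairs flipped a a)
    scaled (no a≢b) = *-cancelˡ-≤ 2 (subst₂ _≤_
      (cong (2 *_) (trans (trans (count₂-disjoint-pair A B (adj G) (adj-sym G) disjoint) (cong (2 *_) edges))
                          (x∙yz≈y∙xz 2 C D)))
      (trans (count₂-disjoint-pair A B distinct distinct-sym disjoint) (cong (2 *_) pairs))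
      (flipped-on-ordered-pairs flipped a b))
      where
      disjoint : ∀ v → (A v ∧ B v) ≡ false
      disjoint v with A v in Av
      ... | false = refl
      ... | true = dec-false (χ v ≟ b) (λ χv≡b → a≢b (trans (sym (does⇒ (χ v ≟ a) Av)) χv≡b))

  non-neighbour-of-colour : Stable G χ → Flipped G χ → ∀ {u y} → adj G u y ≡ true →
    ∃ λ z → χ z ≡ χ y × z ≢ u × adj G u z ≡ false
  non-neighbour-of-colour stable flipped {u} {y} u~y =
    unpack (count-witness (λ z → Others z ∧ not (adj G u z))
             (<-≤-trans (count-positive (λ z → adj G u z ∧ (χ z ≡ᵇ b)) y-counts) D≤non-adjacent))
    where
    b D : ℕ
    b = χ y
    D = colourDegree b u
    Others : V → Bool
    Others = (λ z → χ z ≡ᵇ b) ∖ u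
    y-counts : (adj G u y ∧ (χ y ≡ᵇ b)) ≡ true
    y-counts = cong₂ _∧_ u~y (dec-true (b ≟ b) refl)
    adjacent≤D : count (λ z → Others z ∧ adj G u z) ≤ D
    adjacent≤D = count-mono {p = λ z → Others z ∧ adj G u z} λ z e →
      let others , u~z = ∧-true⇒ {Others z} e in cong₂ _∧_ u~z (proj₁ (∧-true⇒ {χ z ≡ᵇ b} others))
    D≤non-adjacent : D ≤ count (λ z → Others z ∧ not (adj G u z))
    D≤non-adjacent = +-cancelˡ-≤ D _ _ (begin
      D + D                                        ≡⟨ cong (D +_) (sym (+-identityʳ D)) ⟩
      2 * D                                        ≤⟨ colourDegree-bound stable flipped u b ⟩
      count Others                                 ≡⟨ count-split Others (adj G u) ⟩
      count (λ z → Others z ∧ adj G u z) + _       ≤⟨ +-monoˡ-≤ _ adjacent≤D ⟩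
      D + count (λ z → Others z ∧ not (adj G u z)) ∎)
      where open ≤-Reasoning
    unpack : (∃ λ z → (Others z ∧ not (adj G u z)) ≡ true) → ∃ λ z → χ z ≡ χ y × z ≢ u × adj G u z ≡ false
    unpack (z , e) with ∧-true⇒ {Others z} e
    ... | others , u≁z with ∧-true⇒ {χ z ≡ᵇ b} others
    ...   | χz≡b , z≠u = z , does⇒ (χ z ≟ b) χz≡b , ==ᶠ-false⇒≢ (not-injective z≠u) , not-injective u≁z

  common-non-neighbour : Stable G χ → Flipped G χ → ∀ {x₁ x₂ v} → adj G x₁ v ≡ true → adj G x₂ v ≡ true →
    ∃ λ z → χ z ≡ χ v × adj G x₁ z ≡ false × adj G x₂ z ≡ false
  common-non-neighbour stable flipped {x₁} {x₂} {v} x₁~v x₂~v =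
    unpack (count-witness (λ z → B z ∧ not (N z)) (+-cancelˡ-≤ W 1 _ (begin
      W + 1                                       ≤⟨ +-monoʳ-≤ W (count-positive (λ z → N₁ z ∧ N₂ z) v-common) ⟩
      W + count (λ z → N₁ z ∧ N₂ z)               ≡⟨ count-∨ N₁ N₂ ⟩
      count N₁ + count N₂                         ≤⟨ N₁+N₂≤B ⟩
      count B                                     ≡⟨ count-split B N ⟩
      count (λ z → B z ∧ N z) + _                 ≡⟨ cong (_+ count (λ z → B z ∧ not (N z))) (count-cong in-B) ⟩
      W + count (λ z → B z ∧ not (N z))           ∎)))
    where
    open ≤-Reasoning
    b W : ℕ
    b = χ v
    B N N₁ N₂ : V → Bool
    B z = χ z ≡ᵇ b
    N z = adj G x₁ z ∨ adj G x₂ z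
    N₁ z = adj G x₁ z ∧ B z
    N₂ z = adj G x₂ z ∧ B z
    W = count (λ z → N₁ z ∨ N₂ z)
    v-common : (N₁ v ∧ N₂ v) ≡ true
    v-common = trans (cong₂ (λ p q → (p ∧ B v) ∧ (q ∧ B v)) x₁~v x₂~v) (cong (λ t → t ∧ t) (dec-true (b ≟ b) refl))
    half : ∀ x → 2 * colourDegree b x ≤ count B
    half x = ≤-trans (colourDegree-bound stable flipped x b)
                     (count-mono {p = B ∖ x} (λ y e → proj₁ (∧-true⇒ {B y} e)))
    N₁+N₂≤B : count N₁ + count N₂ ≤ count B
    N₁+N₂≤B = *-cancelˡ-≤ 2 (subst₂ _≤_ (sym (*-distribˡ-+ 2 (count N₁) (count N₂)))
      (cong (count B +_) (sym (+-identityʳ (count B)))) (+-mono-≤ (half x₁) (half x₂)))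
    in-B : ∀ z → (B z ∧ N z) ≡ (N₁ z ∨ N₂ z)
    in-B z = trans (∧-comm (B z) (N z)) (∧-distribʳ-∨ (B z) (adj G x₁ z) (adj G x₂ z))
    unpack : (∃ λ z → (B z ∧ not (N z)) ≡ true) → ∃ λ z → χ z ≡ b × adj G x₁ z ≡ false × adj G x₂ z ≡ false
    unpack (z , e) with ∧-true⇒ {B z} e
    ... | χz≡b , ¬Nz = z , does⇒ (χ z ≟ b) χz≡b , ∨-false⇒ {adj G x₁ z} (not-injective ¬Nz)

-- Colour refinement

IsEquivalenceᵇ : ∀ {m} → SameColor m → Set
IsEquivalenceᵇ R = IsEquivalence (λ v w → R v w ≡ true)

sameOf-isEquivalence : ∀ {m} (χ : Fin m → ℕ) → IsEquivalenceᵇ (sameOf χ)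
sameOf-isEquivalence χ = record
  { refl = λ {v} → dec-true (χ v ≟ χ v) refl
  ; sym = λ {v} {w} e → dec-true (χ w ≟ χ v) (sym (does⇒ (χ v ≟ χ w) e))
  ; trans = λ {u} {v} {w} e₁ e₂ → dec-true (χ u ≟ χ w) (trans (does⇒ (χ u ≟ χ v) e₁) (does⇒ (χ v ≟ χ w) e₂))
  }

module _ {m} (χ : Fin m → ℕ) (U : Fin m → Bool) where

  SameAfterIndividualizing : Fin m → Fin m → Set
  SameAfterIndividualizing v w = v ≡ w ⊎ (U v ≡ false × U w ≡ false × χ v ≡ χ w)

  individualize⇒ : ∀ {v w} → individualize χ U v w ≡ true → SameAfterIndividualizing v w
  individualize⇒ {v} {w} e with ∨-true⇒ {v ==ᶠ w} e
  ... | inj₁ v=w = inj₁ (isYes⇒ (v ≟ᶠ w) v=w)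
  ... | inj₂ e′ with ∧-true⇒ {not (U v)} e′
  ...   | ¬Uv , e″ with ∧-true⇒ {not (U w)} e″
  ...     | ¬Uw , χv=χw = inj₂ (not-injective ¬Uv , not-injective ¬Uw , does⇒ (χ v ≟ χ w) χv=χw)

  individualize⁺ : ∀ {v w} → SameAfterIndividualizing v w → individualize χ U v w ≡ true
  individualize⁺ {v} (inj₁ refl) = cong (_∨ _) (isYes-true (v ≟ᶠ v) refl)
  individualize⁺ {v} {w} (inj₂ (¬Uv , ¬Uw , χv≡χw)) =
    trans (cong₂ (λ a b → (v ==ᶠ w) ∨ (not a ∧ not b ∧ (χ v ≡ᵇ χ w))) ¬Uv ¬Uw)
          (trans (cong ((v ==ᶠ w) ∨_) (dec-true (χ v ≟ χ w) χv≡χw)) (∨-zeroʳ _))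

  individualize-isEquivalence : IsEquivalenceᵇ (individualize χ U)
  individualize-isEquivalence = record
    { refl = individualize⁺ (inj₁ refl)
    ; sym = individualize⁺ ∘ symmetric ∘ individualize⇒
    ; trans = λ e₁ e₂ → individualize⁺ (transitive (individualize⇒ e₁) (individualize⇒ e₂))
    }
    where
    symmetric : ∀ {v w} → SameAfterIndividualizing v w → SameAfterIndividualizing w v
    symmetric (inj₁ refl) = inj₁ refl
    symmetric (inj₂ (¬Uv , ¬Uw , χv≡χw)) = inj₂ (¬Uw , ¬Uv , sym χv≡χw)
    transitive : ∀ {u v w} → SameAfterIndividualizing u v → SameAfterIndividualizing v w →
      SameAfterIndividualizing u w
    transitive (inj₁ refl) same = same
    transitive same (inj₁ refl) = same
    transitive (inj₂ (¬Uu , _ , χu≡χv)) (inj₂ (_ , ¬Uw , χv≡χw)) = inj₂ (¬Uu , ¬Uw , trans χu≡χv χv≡χw)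

module _ (G : Graph) where

  private
    V : Set
    V = Fin (n G)

  neighboursIn : SameColor (n G) → V → V → ℕ
  neighboursIn R v x = count (λ y → adj G v y ∧ R y x)

  refine⇒ : ∀ {R v w} → refine G R v w ≡ true → R v w ≡ true × (∀ x → neighboursIn R v x ≡ neighboursIn R w x)
  refine⇒ {R} {v} {w} e with ∧-true⇒ {R v w} e
  ... | Rvw , counts = Rvw , λ x → does⇒ (neighboursIn R v x ≟ neighboursIn R w x) (allᶠ-true⇒ counts x)

  refine⁺ : ∀ {R v w} → R v w ≡ true → (∀ x → neighboursIn R v x ≡ neighboursIn R w x) → refine G R v w ≡ true
  refine⁺ {R} {v} {w} Rvw counts =
    cong₂ _∧_ Rvw (allᶠ-true (λ x → dec-true (neighboursIn R v x ≟ neighboursIn R w x) (counts x)))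

  refine-isEquivalence : ∀ {R} → IsEquivalenceᵇ R → IsEquivalenceᵇ (refine G R)
  refine-isEquivalence {R} E = record
    { refl = refine⁺ E.refl (λ _ → refl)
    ; sym = λ e → let Rvw , counts = refine⇒ e in refine⁺ (E.sym Rvw) (sym ∘ counts)
    ; trans = λ e₁ e₂ → let Ruv , counts₁ = refine⇒ e₁ ; Rvw , counts₂ = refine⇒ e₂ in
        refine⁺ (E.trans Ruv Rvw) (λ x → trans (counts₁ x) (counts₂ x))
    }
    where module E = IsEquivalence E

  wl-isEquivalence : ∀ {R} → IsEquivalenceᵇ R → IsEquivalenceᵇ (wl G R)
  wl-isEquivalence {R} E = go (n G)
    where
    go : ∀ k → IsEquivalenceᵇ (iterate k (refine G) R)
    go zero = E
    go (suc k) = refine-isEquivalence (go k)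

  iterate-refine-⊆ : ∀ k {R v w} → iterate k (refine G) R v w ≡ true → R v w ≡ true
  iterate-refine-⊆ zero e = e
  iterate-refine-⊆ (suc k) e = iterate-refine-⊆ k (proj₁ (refine⇒ e))

  iterate-refine-⊆-refine : ∀ k {R v w} → iterate (suc k) (refine G) R v w ≡ true → refine G R v w ≡ true
  iterate-refine-⊆-refine zero e = e
  iterate-refine-⊆-refine (suc k) e = iterate-refine-⊆-refine k (proj₁ (refine⇒ e))

  wl-⊆-refine : ∀ {R v w} → wl G R v w ≡ true → refine G R v w ≡ true
  wl-⊆-refine {R} {v} {w} = go (n G) (≤-<-trans z≤n (toℕ<n v))
    where
    go : ∀ k → 0 < k → iterate k (refine G) R v w ≡ true → refine G R v w ≡ true
    go (suc k) _ = iterate-refine-⊆-refine k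

module _ (G : Graph) (χ : Fin (n G) → ℕ) (U : Fin (n G) → Bool) where

  χ1-isEquivalence : IsEquivalenceᵇ (χ1 G χ U)
  χ1-isEquivalence = wl-isEquivalence G (individualize-isEquivalence χ U)

  χ1⇒sameOf : ∀ {v w} → χ1 G χ U v w ≡ true → sameOf χ v w ≡ true
  χ1⇒sameOf {v} {w} e with individualize⇒ χ U (iterate-refine-⊆ G (n G) e)
  ... | inj₁ refl = dec-true (χ v ≟ χ v) refl
  ... | inj₂ (_ , _ , χv≡χw) = dec-true (χ v ≟ χ w) χv≡χw

  χ1-individualized : ∀ {u v} → U u ≡ true → v ≢ u → χ1 G χ U u v ≡ false
  χ1-individualized {u} {v} Uu v≢u = ¬-not λ e → absurd (individualize⇒ χ U (iterate-refine-⊆ G (n G) e))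
    where
    absurd : SameAfterIndividualizing χ U u v → ⊥
    absurd (inj₁ u≡v) = v≢u (sym u≡v)
    absurd (inj₂ (¬Uu , _)) = not-¬ Uu ¬Uu

  -- An individualized x forms a class of its own, so neighbours of x are told apart from
  -- non-neighbours already in the first refinement round.
  χ1-separates-neighbours : ∀ {x v w} → U x ≡ true → adj G v x ≡ true → adj G w x ≡ false →
    χ1 G χ U v w ≡ false
  χ1-separates-neighbours {x} {v} {w} Ux v~x w≁x = ¬-not λ e →
    <-irrefl (sym (trans (proj₂ (refine⇒ G (wl-⊆-refine G e)) x) none-at-w))
      (count-positive (λ y → adj G v y ∧ R y x) v-at-x)
    where
    R : SameColor (n G)
    R = individualize χ U
    only-x : ∀ {y} → R y x ≡ true → y ≡ x
    only-x e with individualize⇒ χ U e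
    ... | inj₁ y≡x = y≡x
    ... | inj₂ (_ , ¬Ux , _) = ⊥-elim (not-¬ Ux ¬Ux)
    none-at-w : neighboursIn G R w x ≡ 0
    none-at-w = count-false _ at
      where
      at : ∀ y → (adj G w y ∧ R y x) ≡ false
      at y with R y x in Ryx
      ... | false = ∧-zeroʳ (adj G w y)
      ... | true rewrite only-x Ryx = trans (∧-identityʳ _) w≁x
    v-at-x : (adj G v x ∧ R x x) ≡ true
    v-at-x = cong₂ _∧_ v~x (individualize⁺ χ U (inj₁ refl))

-- Counting colour classes

earlierInClass : ∀ {m} → SameColor m → (Fin m → Bool) → Fin m → Bool
earlierInClass R X v = anyᶠ (λ w → X w ∧ (w <ᶠ v) ∧ R w v)

-- `numColors R X` is by definition `count (firstOfClass R X)`: each class is counted at its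
-- element of X of least index.
firstOfClass : ∀ {m} → SameColor m → (Fin m → Bool) → Fin m → Bool
firstOfClass R X v = X v ∧ not (earlierInClass R X v)

earlierInClass⇒ : ∀ {m} (R : SameColor m) (X : Fin m → Bool) {v} → earlierInClass R X v ≡ true →
  ∃ λ w → X w ≡ true × toℕ w < toℕ v × R w v ≡ true
earlierInClass⇒ R X {v} earlier with anyᶠ-true⇒ earlier
... | w , e with ∧-true⇒ {X w} e
...   | Xw , e′ with ∧-true⇒ {w <ᶠ v} e′
...     | w<v , Rwv = w , Xw , isYes⇒ (toℕ w <? toℕ v) w<v , Rwv

module _ {m} {R : SameColor m} (E : IsEquivalenceᵇ R) (X : Fin m → Bool) where

  private
    module E = IsEquivalence E

  not-firstOfClass : ∀ {v w} → X w ≡ true → toℕ w < toℕ v → R w v ≡ true → firstOfClass R X v ≡ false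
  not-firstOfClass {v} {w} Xw w<v Rwv =
    trans (cong (λ b → X v ∧ not b) (anyᶠ-true {p = λ u → X u ∧ (u <ᶠ v) ∧ R u v} earlier)) (∧-zeroʳ (X v))
    where
    earlier : (X w ∧ (w <ᶠ v) ∧ R w v) ≡ true
    earlier = trans (cong₂ (λ a b → a ∧ b ∧ R w v) Xw (isYes-true (toℕ w <? toℕ v) w<v)) Rwv

  firstOfClass-exists : ∀ {v} → X v ≡ true → ∃ λ r → firstOfClass R X r ≡ true × R r v ≡ true
  firstOfClass-exists {v} = go v (<-wellFounded v)
    where
    go : ∀ v → Acc Fin._<_ v → X v ≡ true → ∃ λ r → firstOfClass R X r ≡ true × R r v ≡ true
    go v (acc earlier-acc) Xv with earlierInClass R X v in earlier
    ... | false = v , cong₂ (λ a b → a ∧ not b) Xv earlier , E.refl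
    ... | true =
      let w , Xw , w<v , Rwv = earlierInClass⇒ R X earlier
          r , first , Rrw = go w (earlier-acc w<v) Xw
      in r , first , E.trans Rrw Rwv

  firstOfClass-unique : ∀ {r₁ r₂} → firstOfClass R X r₁ ≡ true → firstOfClass R X r₂ ≡ true →
    R r₁ r₂ ≡ true → r₁ ≡ r₂
  firstOfClass-unique {r₁} {r₂} first₁ first₂ R₁₂ with <-cmp (toℕ r₁) (toℕ r₂)
  ... | tri≈ _ r₁≡r₂ _ = toℕ-injective r₁≡r₂
  ... | tri< r₁<r₂ _ _ = ⊥-elim (not-¬ first₂ (not-firstOfClass (proj₁ (∧-true⇒ first₁)) r₁<r₂ R₁₂))
  ... | tri> _ _ r₂<r₁ = ⊥-elim (not-¬ first₁ (not-firstOfClass (proj₁ (∧-true⇒ first₂)) r₂<r₁ (E.sym R₁₂)))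

  private
    Representative : Fin m → Fin m → Set
    Representative r e = firstOfClass R X r ≡ true × R r e ≡ true

    representatives : ∀ {es} → All (λ e → X e ≡ true) es → AllPairs (λ e e′ → R e e′ ≡ false) es →
      ∃ λ rs → Unique rs × Pointwise Representative rs es
    representatives [] [] = [] , [] , []
    representatives {e ∷ _} (Xe ∷ Xes) (e-apart ∷ apart) with firstOfClass-exists Xe | representatives Xes apart
    ... | r , first , Rre | rs , unique , reps = r ∷ rs , fresh reps e-apart ∷ unique , (first , Rre) ∷ reps
      where
      fresh : ∀ {rs es} → Pointwise Representative rs es → All (λ e′ → R e e′ ≡ false) es → All (r ≢_) rs
      fresh [] [] = []
      fresh ((_ , Rre′) ∷ reps) (Ree′ ∷ apart) =
        (λ { refl → not-¬ (E.trans (E.sym Rre) Rre′) Ree′ }) ∷ fresh reps apart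

  inequivalent≤classes : (P : Fin m → Bool) → (∀ {r x} → R r x ≡ true → P x ≡ true → P r ≡ true) →
    ∀ {es} → All (λ x → X x ≡ true) es → All (λ x → P x ≡ true) es → AllPairs (λ x y → R x y ≡ false) es →
    length es ≤ count (λ r → firstOfClass R X r ∧ P r)
  inequivalent≤classes P P-closed Xes Pes apart with representatives Xes apart
  ... | rs , unique , reps = subst (_≤ _) (Pointwise-length reps) (length≤count _ unique (marked reps Pes))
    where
    marked : ∀ {rs es} → Pointwise Representative rs es → All (λ x → P x ≡ true) es →
      All (λ r → (firstOfClass R X r ∧ P r) ≡ true) rs
    marked [] [] = []
    marked ((first , Rre) ∷ reps) (Pe ∷ Pes) = cong₂ _∧_ first (P-closed Rre Pe) ∷ marked reps Pes

module Refinement {m} {R R′ : SameColor m} (E : IsEquivalenceᵇ R) (E′ : IsEquivalenceᵇ R′)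
  (R′⊆R : ∀ {v w} → R′ v w ≡ true → R v w ≡ true) (X : Fin m → Bool) where

  private
    module E = IsEquivalence E

  newFirstOfClass : Fin m → Bool
  newFirstOfClass v = firstOfClass R′ X v ∧ not (firstOfClass R X v)

  firstOfClass-refine : ∀ {v} → firstOfClass R X v ≡ true → firstOfClass R′ X v ≡ true
  firstOfClass-refine {v} first with earlierInClass R′ X v in earlier′
  ... | false = trans (∧-identityʳ (X v)) (proj₁ (∧-true⇒ first))
  ... | true =
    let w , Xw , w<v , R′wv = earlierInClass⇒ R′ X earlier′
    in ⊥-elim (not-¬ first (not-firstOfClass E X Xw w<v (R′⊆R R′wv)))

  numColors-refine : numColors R X + count newFirstOfClass ≡ numColors R′ X
  numColors-refine = sym (trans (count-split (firstOfClass R′ X) (firstOfClass R X))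
                                (cong (_+ count newFirstOfClass) (count-cong old)))
    where
    old : ∀ v → (firstOfClass R′ X v ∧ firstOfClass R X v) ≡ firstOfClass R X v
    old v with firstOfClass R X v in first
    ... | true = trans (∧-identityʳ _) (firstOfClass-refine first)
    ... | false = ∧-zeroʳ _

  -- A class of R meeting k pairwise R′-inequivalent elements of X contains at least k R′-classes,
  -- of which at most one is first in its R-class.
  newFirstOfClass-in-class : ∀ {e es} → X e ≡ true → All (λ x → X x ≡ true) es → All (λ x → R x e ≡ true) es →
    AllPairs (λ x y → R′ x y ≡ false) (e ∷ es) → length es ≤ count (λ r → newFirstOfClass r ∧ R r e)
  newFirstOfClass-in-class {e} {es} Xe Xes Res apart = ≤-pred (begin
    suc (length es)
      ≤⟨ inequivalent≤classes E′ X (λ r → R r e) closed (Xe ∷ Xes) (E.refl ∷ Res) apart ⟩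
    count Fine
      ≡⟨ count-split Fine (firstOfClass R X) ⟩
    count (λ r → Fine r ∧ firstOfClass R X r) + count (λ r → Fine r ∧ not (firstOfClass R X r))
      ≤⟨ +-mono-≤ (count-subsingleton _ one-old) (≤-reflexive (count-cong new)) ⟩
    1 + count (λ r → newFirstOfClass r ∧ R r e) ∎)
    where
    open ≤-Reasoning
    Fine : Fin m → Bool
    Fine r = firstOfClass R′ X r ∧ R r e
    closed : ∀ {r x} → R′ r x ≡ true → R x e ≡ true → R r e ≡ true
    closed R′rx Rxe = E.trans (R′⊆R R′rx) Rxe
    one-old : ∀ {r₁ r₂} → (Fine r₁ ∧ firstOfClass R X r₁) ≡ true → (Fine r₂ ∧ firstOfClass R X r₂) ≡ true →
      r₁ ≡ r₂
    one-old {r₁} {r₂} e₁ e₂ with ∧-true⇒ {Fine r₁} e₁ | ∧-true⇒ {Fine r₂} e₂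
    ... | fine₁ , first₁ | fine₂ , first₂ = firstOfClass-unique E X first₁ first₂ (E.trans
      (proj₂ (∧-true⇒ {firstOfClass R′ X r₁} fine₁)) (E.sym (proj₂ (∧-true⇒ {firstOfClass R′ X r₂} fine₂))))
    new : ∀ r → (Fine r ∧ not (firstOfClass R X r)) ≡ (newFirstOfClass r ∧ R r e)
    new r with firstOfClass R′ X r | firstOfClass R X r | R r e
    ... | true | true | _ = ∧-zeroʳ _
    ... | true | false | _ = ∧-identityʳ _
    ... | false | _ | _ = refl

  in-class⊆newFirstOfClass : ∀ {e} → (λ r → newFirstOfClass r ∧ R r e) ⊆ᵇ newFirstOfClass
  in-class⊆newFirstOfClass r = proj₁ ∘ ∧-true⇒ {newFirstOfClass r}

  numColors-gain-in-class : ∀ {e es} → X e ≡ true → All (λ x → X x ≡ true) es → All (λ x → R x e ≡ true) es →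
    AllPairs (λ x y → R′ x y ≡ false) (e ∷ es) → numColors R X + length es ≤ numColors R′ X
  numColors-gain-in-class Xe Xes Res apart = subst (_ ≤_) numColors-refine (+-monoʳ-≤ _
    (≤-trans (newFirstOfClass-in-class Xe Xes Res apart) (count-mono in-class⊆newFirstOfClass)))

  numColors-gain-in-two-classes : ∀ {e es f fs} → R e f ≡ false →
    X e ≡ true → All (λ x → X x ≡ true) es → All (λ x → R x e ≡ true) es →
    AllPairs (λ x y → R′ x y ≡ false) (e ∷ es) →
    X f ≡ true → All (λ x → X x ≡ true) fs → All (λ x → R x f ≡ true) fs →
    AllPairs (λ x y → R′ x y ≡ false) (f ∷ fs) →
    numColors R X + (length es + length fs) ≤ numColors R′ X
  numColors-gain-in-two-classes {e} {es} {f} {fs} Ref Xe Xes Res apart-e Xf Xfs Rfs apart-f =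
    subst (_ ≤_) numColors-refine (+-monoʳ-≤ _ (≤-trans
      (+-mono-≤ (newFirstOfClass-in-class Xe Xes Res apart-e) (newFirstOfClass-in-class Xf Xfs Rfs apart-f))
      (count-disjoint-≤ disjoint in-class⊆newFirstOfClass in-class⊆newFirstOfClass)))
    where
    disjoint : ∀ r → ((newFirstOfClass r ∧ R r e) ∧ (newFirstOfClass r ∧ R r f)) ≡ false
    disjoint r with R r e in Rre | R r f in Rrf
    ... | true | true = ⊥-elim (not-¬ (E.trans (E.sym Rre) Rrf) Ref)
    ... | true | false = trans (cong ((newFirstOfClass r ∧ true) ∧_) (∧-zeroʳ (newFirstOfClass r))) (∧-zeroʳ _)
    ... | false | b = cong (_∧ (newFirstOfClass r ∧ b)) (∧-zeroʳ (newFirstOfClass r))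

-- Vertex covers of 1-robust graphs

edge-exists : (G : Graph) → Connected G → 1 < n G → ∃ λ a → ∃ λ c → adj G a c ≡ true
edge-exists G connected 1<n = first-step (connected v₀ v₁) v₀≢v₁
  where
  v₀ v₁ : Fin (n G)
  v₀ = fromℕ< (<-trans (s≤s z≤n) 1<n)
  v₁ = fromℕ< 1<n
  v₀≢v₁ : v₀ ≢ v₁
  v₀≢v₁ v₀≡v₁ with trans (sym (toℕ-fromℕ< (<-trans (s≤s z≤n) 1<n))) (trans (cong toℕ v₀≡v₁) (toℕ-fromℕ< 1<n))
  ... | ()
  first-step : ∀ {a c} → Star (λ x y → T (adj G x y)) a c → a ≢ c → ∃ λ a → ∃ λ c → adj G a c ≡ true
  first-step ε a≢c = ⊥-elim (a≢c refl)
  first-step (_◅_ {j = c} a~c _) _ = _ , c , Equivalence.to T-≡ a~c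

module Configurations (G : Graph) (χ : Fin (n G) → ℕ) (robust : OneRobust G χ) (S : Fin (n G) → Bool)
  (cover : VertexCover G S) (separated : ∀ v w → T (S v) → T (not (S w)) → χ v ≢ χ w) where

  open OneRobust robust

  private
    V : Set
    V = Fin (n G)
    module Gain (U : V → Bool) = Refinement (sameOf-isEquivalence χ) (χ1-isEquivalence G χ U) (χ1⇒sameOf G χ U) S

  Gain₂ Gain₃ : (V → Bool) → Set
  Gain₂ U = numColors (sameOf χ) S + 2 ≤ numColors (χ1 G χ U) S
  Gain₃ U = numColors (sameOf χ) S + 3 ≤ numColors (χ1 G χ U) S

  EdgeInS : Set
  EdgeInS = ∃ λ v → ∃ λ w → S v ≡ true × S w ≡ true × adj G v w ≡ true

  ColourfulIVertex : Set
  ColourfulIVertex = ∃ λ x → ∃ λ v₁ → ∃ λ v₂ → S x ≡ false × adj G x v₁ ≡ true × adj G x v₂ ≡ true × χ v₁ ≢ χ v₂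

  Crossing : Set
  Crossing = ∃ λ v → ∃ λ x₁ → ∃ λ x₂ → ∃ λ a₁ → ∃ λ a₂ → S v ≡ true × adj G v x₁ ≡ true × adj G v x₂ ≡ true ×
    adj G x₁ a₁ ≡ true × adj G x₂ a₁ ≡ false × adj G x₂ a₂ ≡ true × adj G x₁ a₂ ≡ false

  edge-in-S? : Dec EdgeInS
  edge-in-S? = any? λ v → any? λ w → (S v Bool.≟ true) ×-dec (S w Bool.≟ true) ×-dec (adj G v w Bool.≟ true)

  colourful-I-vertex? : Dec ColourfulIVertex
  colourful-I-vertex? = any? λ x → any? λ v₁ → any? λ v₂ →
    (S x Bool.≟ false) ×-dec (adj G x v₁ Bool.≟ true) ×-dec (adj G x v₂ Bool.≟ true) ×-dec ¬? (χ v₁ ≟ χ v₂)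

  crossing? : Dec Crossing
  crossing? = any? λ v → any? λ x₁ → any? λ x₂ → any? λ a₁ → any? λ a₂ →
    (S v Bool.≟ true) ×-dec (adj G v x₁ Bool.≟ true) ×-dec (adj G v x₂ Bool.≟ true) ×-dec
    (adj G x₁ a₁ Bool.≟ true) ×-dec (adj G x₂ a₁ Bool.≟ false) ×-dec
    (adj G x₂ a₂ Bool.≟ true) ×-dec (adj G x₁ a₂ Bool.≟ false)

  S-colour-closed : ∀ {v z} → S v ≡ true → χ z ≡ χ v → S z ≡ true
  S-colour-closed {v} {z} Sv χz≡χv with S z in Sz
  ... | true = refl
  ... | false = ⊥-elim (separated v z (Equivalence.from T-≡ Sv) (Equivalence.from T-≡ (cong not Sz)) (sym χz≡χv))

  covered : ∀ {x v} → S x ≡ false → adj G x v ≡ true → S v ≡ true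
  covered {x} {v} Sx x~v with Equivalence.to T-≡ (cover x v (Equivalence.from T-≡ x~v))
  ... | Sx∨Sv rewrite Sx = Sx∨Sv

  same-colour : ∀ {x e} → χ x ≡ χ e → sameOf χ x e ≡ true
  same-colour {x} {e} = dec-true (χ x ≟ χ e)

  adj-flip : ∀ {v w} → adj G v w ≡ true → adj G w v ≡ true
  adj-flip {v} {w} v~w = trans (adj-sym G w v) v~w

  non-adj-flip : ∀ {v w} → adj G v w ≡ false → adj G w v ≡ false
  non-adj-flip {v} {w} v≁w = trans (adj-sym G w v) v≁w

  non-adjacent⇒≢ : ∀ {x y z} → adj G x y ≡ true → adj G x z ≡ false → z ≢ y
  non-adjacent⇒≢ x~y x≁z refl = not-¬ x~y x≁z

  individualized : (u : V) → singleton u u ≡ true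
  individualized u = isYes-true (u ≟ᶠ u) refl

  separated-by : ∀ U {x v w} → U x ≡ true → adj G x v ≡ true → adj G x w ≡ false → χ1 G χ U v w ≡ false
  separated-by U x∈U x~v x≁w = χ1-separates-neighbours G χ U x∈U (adj-flip x~v) (non-adj-flip x≁w)

  gain-from-edge-in-S : ∀ {v w} → S v ≡ true → S w ≡ true → adj G v w ≡ true → Gain₂ (singleton v)
  gain-from-edge-in-S {v} {w} Sv Sw v~w = by-colours (χ v ≟ χ w)
    where
    apart : ∀ {y} → y ≢ v → χ1 G χ (singleton v) v y ≡ false
    apart = χ1-individualized G χ (singleton v) (individualized v)
    by-colours : Dec (χ v ≡ χ w) → Gain₂ (singleton v)
    by-colours (yes χv≡χw) =
      let z , χz≡χw , z≢v , v≁z = non-neighbour-of-colour G χ stable flipped v~w in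
      Gain.numColors-gain-in-class (singleton v) Sv (Sw ∷ S-colour-closed Sw χz≡χw ∷ [])
        (same-colour (sym χv≡χw) ∷ same-colour (trans χz≡χw (sym χv≡χw)) ∷ [])
        ((apart (non-adjacent⇒≢ v~w (irrefl G v) ∘ sym) ∷ apart z≢v ∷ [])
         ∷ (separated-by (singleton v) (individualized v) v~w v≁z ∷ []) ∷ [] ∷ [])
    by-colours (no χv≢χw) =
      let z₁ , χz₁≡χv , _ , w≁z₁ = non-neighbour-of-colour G χ stable flipped (adj-flip v~w)
          z₂ , χz₂≡χw , _ , v≁z₂ = non-neighbour-of-colour G χ stable flipped v~w in
      Gain.numColors-gain-in-two-classes (singleton v) (dec-false (χ v ≟ χ w) χv≢χw)
        Sv (S-colour-closed Sv χz₁≡χv ∷ []) (same-colour χz₁≡χv ∷ [])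
        ((apart (non-adjacent⇒≢ (adj-flip v~w) w≁z₁) ∷ []) ∷ [] ∷ [])
        Sw (S-colour-closed Sw χz₂≡χw ∷ []) (same-colour χz₂≡χw ∷ [])
        ((separated-by (singleton v) (individualized v) v~w v≁z₂ ∷ []) ∷ [] ∷ [])

  gain-from-colourful-I-vertex : ∀ {x v₁ v₂} → S x ≡ false → adj G x v₁ ≡ true → adj G x v₂ ≡ true →
    χ v₁ ≢ χ v₂ → Gain₂ (singleton x)
  gain-from-colourful-I-vertex {x} {v₁} {v₂} Sx x~v₁ x~v₂ χv₁≢χv₂ =
    let z₁ , χz₁≡χv₁ , _ , x≁z₁ = non-neighbour-of-colour G χ stable flipped x~v₁
        z₂ , χz₂≡χv₂ , _ , x≁z₂ = non-neighbour-of-colour G χ stable flipped x~v₂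
        Sv₁ = covered Sx x~v₁
        Sv₂ = covered Sx x~v₂ in
    Gain.numColors-gain-in-two-classes (singleton x) (dec-false (χ v₁ ≟ χ v₂) χv₁≢χv₂)
      Sv₁ (S-colour-closed Sv₁ χz₁≡χv₁ ∷ []) (same-colour χz₁≡χv₁ ∷ [])
      ((separated-by (singleton x) (individualized x) x~v₁ x≁z₁ ∷ []) ∷ [] ∷ [])
      Sv₂ (S-colour-closed Sv₂ χz₂≡χv₂ ∷ []) (same-colour χz₂≡χv₂ ∷ [])
      ((separated-by (singleton x) (individualized x) x~v₂ x≁z₂ ∷ []) ∷ [] ∷ [])

  gain-from-crossing : ¬ EdgeInS → ¬ ColourfulIVertex → ∀ {v x₁ x₂ a₁ a₂} → S v ≡ true →
    adj G v x₁ ≡ true → adj G v x₂ ≡ true → adj G x₁ a₁ ≡ true → adj G x₂ a₁ ≡ false →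
    adj G x₂ a₂ ≡ true → adj G x₁ a₂ ≡ false → Gain₃ (pair x₁ x₂)
  gain-from-crossing no-edge monochromatic {v} {x₁} {x₂} {a₁} {a₂} Sv v~x₁ v~x₂ x₁~a₁ x₂≁a₁ x₂~a₂ x₁≁a₂ =
    let z , χz≡χv , x₁≁z , x₂≁z = common-non-neighbour G χ stable flipped (adj-flip v~x₁) (adj-flip v~x₂) in
    Gain.numColors-gain-in-class (pair x₁ x₂) Sv
      (S-colour-closed Sv χa₁≡χv ∷ S-colour-closed Sv χa₂≡χv ∷ S-colour-closed Sv χz≡χv ∷ [])
      (same-colour χa₁≡χv ∷ same-colour χa₂≡χv ∷ same-colour χz≡χv ∷ [])
      ((by x₂∈U (adj-flip v~x₂) x₂≁a₁ ∷ by x₁∈U (adj-flip v~x₁) x₁≁a₂ ∷ by x₁∈U (adj-flip v~x₁) x₁≁z ∷ [])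
       ∷ (by x₁∈U x₁~a₁ x₁≁a₂ ∷ by x₁∈U x₁~a₁ x₁≁z ∷ [])
       ∷ (by x₂∈U x₂~a₂ x₂≁z ∷ [])
       ∷ [] ∷ [])
    where
    by : ∀ {x p q} → pair x₁ x₂ x ≡ true → adj G x p ≡ true → adj G x q ≡ false → χ1 G χ (pair x₁ x₂) p q ≡ false
    by = separated-by (pair x₁ x₂)
    x₁∈U : pair x₁ x₂ x₁ ≡ true
    x₁∈U = cong (_∨ (x₂ ==ᶠ x₁)) (isYes-true (x₁ ≟ᶠ x₁) refl)
    x₂∈U : pair x₁ x₂ x₂ ≡ true
    x₂∈U = trans (cong ((x₁ ==ᶠ x₂) ∨_) (isYes-true (x₂ ≟ᶠ x₂) refl)) (∨-zeroʳ _)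
    in-I : ∀ {x} → adj G v x ≡ true → S x ≡ false
    in-I {x} v~x = ¬-not λ Sx → no-edge (v , x , Sv , Sx , v~x)
    same-colour-neighbours : ∀ {x p q} → S x ≡ false → adj G x p ≡ true → adj G x q ≡ true → χ p ≡ χ q
    same-colour-neighbours {x} {p} {q} Sx x~p x~q with χ p ≟ χ q
    ... | yes χp≡χq = χp≡χq
    ... | no χp≢χq = ⊥-elim (monochromatic (x , p , q , Sx , x~p , x~q , χp≢χq))
    χa₁≡χv : χ a₁ ≡ χ v
    χa₁≡χv = same-colour-neighbours (in-I v~x₁) x₁~a₁ (adj-flip v~x₁)
    χa₂≡χv : χ a₂ ≡ χ v
    χa₂≡χv = same-colour-neighbours (in-I v~x₂) x₂~a₂ (adj-flip v~x₂)

  Dominated : V → V → Set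
  Dominated x₀ y = (S y ≡ true → adj G x₀ y ≡ true) × (S y ≡ false → ∀ a → adj G y a ≡ true → adj G x₀ a ≡ true)

  -- From S to I the invariant survives because, with no crossing at y, the neighbourhoods of x₀
  -- and y′ are comparable, and x₀ has maximum degree in I.
  dominated-step : ¬ EdgeInS → ¬ Crossing → ∀ {x₀} → (∀ y → S y ≡ false → count (adj G y) ≤ count (adj G x₀)) →
    ∀ {y y′} → Dominated x₀ y → adj G y y′ ≡ true → Dominated x₀ y′
  dominated-step no-edge no-crossing {x₀} maximal {y} {y′} (S-dominated , I-dominated) y~y′ =
    cases (S y) (S y′) refl refl
    where
    I-neighbourhood : S y ≡ true → S y′ ≡ false → ∀ a → adj G y′ a ≡ true → adj G x₀ a ≡ true
    I-neighbourhood Sy Sy′ a y′~a = ¬-not λ x₀≁a →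
      not-¬ (count-≤⇒⊇ {p = adj G x₀} {q = adj G y′} (N[x₀]⊆N[y′] x₀≁a) (maximal y′ Sy′) a y′~a) x₀≁a
      where
      N[x₀]⊆N[y′] : adj G x₀ a ≡ false → ∀ a₁ → adj G x₀ a₁ ≡ true → adj G y′ a₁ ≡ true
      N[x₀]⊆N[y′] x₀≁a a₁ x₀~a₁ = ¬-not λ y′≁a₁ →
        no-crossing (y , x₀ , y′ , a₁ , a , Sy , adj-flip (S-dominated Sy) , y~y′ , x₀~a₁ , y′≁a₁ , y′~a , x₀≁a)
    cases : ∀ b b′ → S y ≡ b → S y′ ≡ b′ → Dominated x₀ y′
    cases true true Sy Sy′ = ⊥-elim (no-edge (y , y′ , Sy , Sy′ , y~y′))
    cases false false Sy Sy′ = ⊥-elim (not-¬ (covered Sy y~y′) Sy′)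
    cases false true Sy Sy′ = (λ _ → I-dominated Sy y′ y~y′) , λ Sy′≡false → ⊥-elim (not-¬ Sy′ Sy′≡false)
    cases true false Sy Sy′ = (λ Sy′≡true → ⊥-elim (not-¬ Sy′≡true Sy′)) , λ _ → I-neighbourhood Sy Sy′

  dominated-walk : ¬ EdgeInS → ¬ Crossing → ∀ {x₀} → (∀ y → S y ≡ false → count (adj G y) ≤ count (adj G x₀)) →
    ∀ {y w} → Dominated x₀ y → Star (λ a c → T (adj G a c)) y w → Dominated x₀ w
  dominated-walk no-edge no-crossing maximal dominated ε = dominated
  dominated-walk no-edge no-crossing maximal dominated (y~y′ ◅ walk) = dominated-walk no-edge no-crossing maximal
    (dominated-step no-edge no-crossing maximal dominated (Equivalence.to T-≡ y~y′)) walk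

  I-vertex-with-neighbour : 1 < n G → ¬ EdgeInS → ∃ λ x → ∃ λ s → S x ≡ false × adj G x s ≡ true
  I-vertex-with-neighbour 1<n no-edge with edge-exists G connected 1<n
  ... | a , c , a~c with S a in Sa
  ...   | false = a , c , Sa , a~c
  ...   | true = c , a , ¬-not (λ Sc → no-edge (a , c , Sa , Sc , a~c)) , adj-flip a~c

  no-configuration : 1 < n G → ¬ EdgeInS → ¬ Crossing → ⊥
  no-configuration 1<n no-edge no-crossing =
    let x , s , Sx , x~s = I-vertex-with-neighbour 1<n no-edge
        x₀ , ¬Sx₀ , maximal = maximum-on (λ y → count (adj G y)) (λ y → not (S y)) (cong not Sx)
        s₀ , x₀~s₀ = count-witness (adj G x₀) (≤-trans (count-positive (adj G x) x~s) (maximal x (cong not Sx)))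
        z , χz≡χs₀ , _ , x₀≁z = non-neighbour-of-colour G χ stable flipped x₀~s₀
        Sz = S-colour-closed (covered (not-injective ¬Sx₀) x₀~s₀) χz≡χs₀
        x₀-dominated = (λ Sx₀ → ⊥-elim (not-¬ Sx₀ (not-injective ¬Sx₀))) , λ _ _ x₀~a → x₀~a
        S-dominated , _ =
          dominated-walk no-edge no-crossing (λ y Sy → maximal y (cong not Sy)) x₀-dominated (connected x₀ z)
    in not-¬ (S-dominated Sz) x₀≁z

lemma20 : (G : Graph) (χ : Fin (n G) → ℕ) → OneRobust G χ → 1 < n G →
    (S : Fin (n G) → Bool) → VertexCover G S →
    (∀ v w → T (S v) → T (not (S w)) → χ v ≢ χ w) →
    (∃ λ u → numColors (sameOf χ) S + 2 ≤ numColors (χ1 G χ (singleton u)) S)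
    ⊎ (∃₂ λ u₁ u₂ → numColors (sameOf χ) S + 3 ≤ numColors (χ1 G χ (pair u₁ u₂)) S)
lemma20 G χ robust 1<n S cover separated = by-cases edge-in-S? colourful-I-vertex? crossing?
  where
  open Configurations G χ robust S cover separated
  by-cases : Dec EdgeInS → Dec ColourfulIVertex → Dec Crossing →
    (∃ λ u → Gain₂ (singleton u)) ⊎ (∃₂ λ u₁ u₂ → Gain₃ (pair u₁ u₂))
  by-cases (yes (v , _ , Sv , Sw , v~w)) _ _ = inj₁ (v , gain-from-edge-in-S Sv Sw v~w)
  by-cases (no _) (yes (x , _ , _ , Sx , x~v₁ , x~v₂ , χv₁≢χv₂)) _ =
    inj₁ (x , gain-from-colourful-I-vertex Sx x~v₁ x~v₂ χv₁≢χv₂)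
  by-cases (no no-edge) (no monochromatic)
           (yes (_ , x₁ , x₂ , _ , _ , Sv , v~x₁ , v~x₂ , x₁~a₁ , x₂≁a₁ , x₂~a₂ , x₁≁a₂)) =
    inj₂ (x₁ , x₂ , gain-from-crossing no-edge monochromatic Sv v~x₁ v~x₂ x₁~a₁ x₂≁a₁ x₂~a₂ x₁≁a₂)
  by-cases (no no-edge) (no _) (no no-crossing) = ⊥-elim (no-configuration 1<n no-edge no-crossing)
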